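{- Let $n\ge 1$, let $E^n=\{0,1\}^n$, and let $S\subseteq E^n$ be nonempty with characteristic function $\chi^S$. (a) If $\rho(S)\le 1/2$, then $$\mathrm{nei}(S)+2(\mathrm{cor}(S)+1)(1-\rho(S))\le n.$$ (b) $\chi^S$ is a perfect $2$-coloring of $E^n$ if and only if $$\mathrm{nei}(S)+2(\mathrm{cor}(S)+1)(1-\rho(S))= n.$$
   Context: $E^n=\{0,1\}^n$ is the Boolean $n$-cube. For $x,y\in E^n$ put $[x,y]=(x_1y_1,\dots,x_ny_n)$, and let $wt(y)$ be the number of coordinates of $y$ equal to $1$. For $y,z\in E^n$ the face is $E^n_y(z)=\{x\in E^n: [x,y]=[z,y]\}$; it is the set of vectors agreeing with $z$ on the $wt(y)$ coordinates where $y$ is $1$. The function $\chi^S$ is correlation-immune of order $t$ if for every $y\in E^n$ with $wt(y)=t$ the cardinality $|E^n_y(z)\cap S|$ does not depend on $z\in E^n$. $\mathrm{cor}(S)$ is the maximum $t\in\{0,\dots,n\}$ for which $\chi^S$ is correlation-immune of order $t$. Order $0$ always holds. The density is $\rho(S)=|S|/2^n$. $d(x,y)$ is the Hamming distance, and $B(x)=\{y\in E^n: d(x,y)\le 1\}$. The neighbors number is $$\mathrm{nei}(S)=\frac{1}{|S|}\sum_{x\in S}|B(x)\cap S|-1,$$ the average number of neighbors in $S$ of vertices in $S$. A map $Col:E^n\to\{0,1\}$ (here $Col=\chi^S$) is a perfect $2$-coloring if there are numbers $a_{ij}$, $i,j\in\{0,1\}$, such that every vertex of color $i$ has exactly $a_{ij}$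 neighbors of color $j$. Here neighbors are vertices at Hamming distance $1$. -}

module Defs where

open import Data.Bool using (Bool; true; false; _∧_; if_then_else_)
open import Data.Nat as ℕ using (ℕ; zero; suc; _+_; _*_; _^_; _≡ᵇ_)
open import Data.Integer using (+_)
open import Data.List using (List; []; _∷_; map; _++_)
open import Data.Vec using (Vec; []; _∷_; zipWith)
open import Data.Product using (Σ; ∃; _×_; _,_)
open import Relation.Binary.PropositionalEquality using (_≡_)
open import Data.Rational using (ℚ; _/_; 0ℚ)

Cube : ℕ → Set
Cube n = Vec Bool n

allVecs : (n : ℕ) → List (Cube n)
allVecs zero = [] ∷ []
allVecs (suc n) = map (false ∷_) (allVecs n) ++ map (true ∷_) (allVecs n)

countTrue : {A : Set} → (A → Bool) → List A → ℕ
countTrue p [] = 0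
countTrue p (x ∷ xs) = (if p x then 1 else 0) + countTrue p xs

sumL : {A : Set} → (A → ℕ) → List A → ℕ
sumL f [] = 0
sumL f (x ∷ xs) = f x + sumL f xs

wt : {n : ℕ} → Cube n → ℕ
wt [] = 0
wt (true ∷ x) = suc (wt x)
wt (false ∷ x) = wt x

dist : {n : ℕ} → Cube n → Cube n → ℕ
dist [] [] = 0
dist (a ∷ x) (b ∷ y) = (if (a Data.Bool.xor b) then 1 else 0) + dist x y
  where import Data.Bool

prod : {n : ℕ} → Cube n → Cube n → Cube n
prod = zipWith _∧_

eqV : {n : ℕ} → Cube n → Cube n → Bool
eqV [] [] = true
eqV (a ∷ x) (b ∷ y) = (if a then b else Data.Bool.not b) ∧ eqV x y
  where import Data.Bool

Subset : ℕ → Set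
Subset n = Cube n → Bool

card : {n : ℕ} → Subset n → ℕ
card {n} S = countTrue S (allVecs n)

-- x ∈ E^n_y(z), i.e. [x,y] = [z,y]
inFace : {n : ℕ} → Cube n → Cube n → Cube n → Bool
inFace y z x = eqV (prod x y) (prod z y)

faceCount : {n : ℕ} → Subset n → Cube n → Cube n → ℕ
faceCount {n} S y z = countTrue (λ x → inFace y z x ∧ S x) (allVecs n)

CorrImmune : {n : ℕ} → Subset n → ℕ → Set
CorrImmune {n} S t =
  (y : Cube n) → wt y ≡ t → (z z' : Cube n) → faceCount S y z ≡ faceCount S y z'

IsCor : {n : ℕ} → Subset n → ℕ → Set
IsCor {n} S c =
  (c ℕ.≤ n) × CorrImmune S c × ((t : ℕ) → t ℕ.≤ n → CorrImmune S t → t ℕ.≤ c)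

-- a / b as a rational (b = 0 never occurs in the uses below: |S| > 0, 2^n > 0)
frac : ℕ → ℕ → ℚ
frac a zero = 0ℚ
frac a (suc b) = (+ a) / suc b

density : {n : ℕ} → Subset n → ℚ
density {n} S = frac (card S) (2 ^ n)

ballCount : {n : ℕ} → Subset n → Cube n → ℕ
ballCount {n} S x = countTrue (λ y → S y ∧ (dist x y ℕ.≤ᵇ 1)) (allVecs n)

nei : {n : ℕ} → Subset n → ℚ
nei {n} S =
  frac (sumL (λ x → if S x then ballCount S x else 0) (allVecs n)) (card S)
    Data.Rational.- Data.Rational.1ℚ
  where import Data.Rational

nbColour : {n : ℕ} → (Cube n → Bool) → Cube n → Bool → ℕ
nbColour {n} Col x j =
  countTrue (λ y → (dist x y ≡ᵇ 1) ∧ (if Col y then j else Data.Bool.not j)) (allVecs n)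
  where import Data.Bool

PerfectColouring : {n : ℕ} → (Cube n → Bool) → Set
PerfectColouring {n} Col =
  Σ (Bool → Bool → ℕ) λ a → (x : Cube n) → (j : Bool) → nbColour Col x j ≡ a (Col x) j

NonEmpty : {n : ℕ} → Subset n → Set
NonEmpty {n} S = Σ (Cube n) λ x → S x ≡ true

ℕtoℚ : ℕ → ℚ
ℕtoℚ k = (+ k) / 1

-- Let f be the 0/1 indicator of S and f̂(u) = Σₓ f(x) (−1)^(u·x) its Walsh transform. Summing f over the
-- faces E_y(z) shows that correlation immunity of order t means f̂(u) = 0 for 1 ≤ wt u ≤ t. The adjacency
-- operator is diagonal on the characters, with eigenvalue n − 2 wt u, so Parseval gives
-- Σ_u f̂(u)² = 2ⁿ|S| and Σ_u (n − 2 wt u) f̂(u)² = 2ⁿ Σ_{x ∈ S} |N(x) ∩ S|, while f̂(0) = |S|.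
-- Together,
--   2 Σ_{u ≠ 0} (wt u − cor(S) − 1) f̂(u)² = 2ⁿ |S| (n − nei(S) − 2 (cor(S) + 1) (1 − ρ(S))),
-- and every term on the left is nonnegative because f̂ vanishes on the weights 1 .. cor(S). Equality holds
-- iff the nonzero spectrum lies on the single weight cor(S) + 1. That makes adj f − (n − 2 (cor(S) + 1)) f
-- constant, i.e. S a perfect colouring; conversely a perfect colouring has its nonzero spectrum on a single
-- eigenvalue of the adjacency operator, and the maximality of cor(S) pins its weight to cor(S) + 1.

module Submission where

open import Defs

open import Data.Bool using (Bool; true; false; not; _∧_; if_then_else_)
import Data.Bool.Properties as Bool
open import Data.Empty using (⊥-elim)
open import Data.Integer using (ℤ; +_; -[1+_]; 0ℤ; 1ℤ; -1ℤ; _+_; _-_; _*_; -_; _≤_; +≤+)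
import Data.Integer.Properties as ℤP
open import Data.Integer.Tactic.RingSolver using (solve-∀)
open import Data.List using ([]; _∷_; map; _++_)
open import Data.List.Membership.Propositional using (_∈_; lose)
open import Data.List.Membership.Propositional.Properties using (∈-map⁺; ∈-++⁺ˡ; ∈-++⁺ʳ)
open import Data.List.Relation.Unary.Any using (here; there; any?; satisfied)
open import Data.Nat as ℕ using (ℕ; zero; suc; z≤n; s≤s; _≡ᵇ_; _≤ᵇ_; _≥_)
import Data.Nat.Properties as ℕP
open import Data.Product using (Σ-syntax; _×_; _,_; proj₁; proj₂)
open import Data.Rational as ℚ using (ℚ; 0ℚ; 1ℚ; ½; toℚᵘ; Positive)
import Data.Rational.Properties as ℚP
open import Data.Rational.Unnormalised using (mkℚᵘ; *≡*; *≤*) renaming (_≃_ to _≃ᵘ_)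
import Data.Rational.Unnormalised.Properties as ℚᵘP
open import Data.Sum using (_⊎_; inj₁; inj₂; reduce; map₁)
open import Data.Vec using ([]; _∷_; replicate)
open import Function.Bundles using (_⇔_; mk⇔; Equivalence)
open import Function.Properties.Equivalence using () renaming (sym to ⇔-sym; trans to ⇔-trans)
open import Level using (0ℓ)
open import Relation.Binary.PropositionalEquality
open import Relation.Nullary using (yes; no)
open import Relation.Nullary.Decidable using (dec⇒maybe)
import Tactic.RingSolver as RingSolver
import Tactic.RingSolver.Core.AlmostCommutativeRing as ACR

open ≡-Reasoning

-- Sums over the cube and the Walsh transform

_↾_ : ∀ {n} {A : Set} → (Cube (suc n) → A) → Bool → Cube n → A
(f ↾ b) x = f (b ∷ x)

∑ : ∀ {n} → (Cube n → ℤ) → ℤ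
∑ {zero} f = f []
∑ {suc n} f = ∑ (f ↾ false) + ∑ (f ↾ true)

∑-cong : ∀ {n} {f g : Cube n → ℤ} → (∀ x → f x ≡ g x) → ∑ f ≡ ∑ g
∑-cong {zero} f≗g = f≗g []
∑-cong {suc n} f≗g = cong₂ _+_ (∑-cong (λ x → f≗g (false ∷ x))) (∑-cong (λ x → f≗g (true ∷ x)))

∑-+ : ∀ {n} (f g : Cube n → ℤ) → ∑ (λ x → f x + g x) ≡ ∑ f + ∑ g
∑-+ {zero} f g = refl
∑-+ {suc n} f g = begin
  ∑ (λ x → f (false ∷ x) + g (false ∷ x)) + ∑ (λ x → f (true ∷ x) + g (true ∷ x))
    ≡⟨ cong₂ _+_ (∑-+ (f ↾ false) (g ↾ false)) (∑-+ (f ↾ true) (g ↾ true)) ⟩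
  (∑ (f ↾ false) + ∑ (g ↾ false)) + (∑ (f ↾ true) + ∑ (g ↾ true))
    ≡⟨ interchange (∑ (f ↾ false)) (∑ (g ↾ false)) (∑ (f ↾ true)) (∑ (g ↾ true)) ⟩
  ∑ f + ∑ g ∎
  where
  interchange : ∀ a b c d → (a + b) + (c + d) ≡ (a + c) + (b + d)
  interchange = solve-∀

∑-* : ∀ {n} (k : ℤ) (f : Cube n → ℤ) → ∑ (λ x → k * f x) ≡ k * ∑ f
∑-* {zero} k f = refl
∑-* {suc n} k f = trans (cong₂ _+_ (∑-* k (f ↾ false)) (∑-* k (f ↾ true)))
                        (sym (ℤP.*-distribˡ-+ k _ _))

∑-lin : ∀ {n} (a b : ℤ) (f g : Cube n → ℤ) →
        ∑ (λ x → a * f x + b * g x) ≡ a * ∑ f + b * ∑ g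
∑-lin a b f g = trans (∑-+ (λ x → a * f x) (λ x → b * g x)) (cong₂ _+_ (∑-* a f) (∑-* b g))

∑-neg : ∀ {n} (f : Cube n → ℤ) → ∑ (λ x → - f x) ≡ - ∑ f
∑-neg {zero} f = refl
∑-neg {suc n} f = trans (cong₂ _+_ (∑-neg (f ↾ false)) (∑-neg (f ↾ true)))
                        (sym (ℤP.neg-distrib-+ (∑ (f ↾ false)) (∑ (f ↾ true))))

∑-0 : ∀ {n} → ∑ {n} (λ _ → 0ℤ) ≡ 0ℤ
∑-0 {zero} = refl
∑-0 {suc n} = cong₂ _+_ (∑-0 {n}) (∑-0 {n})

∑-nonneg : ∀ {n} (f : Cube n → ℤ) → (∀ x → 0ℤ ≤ f x) → 0ℤ ≤ ∑ f
∑-nonneg {zero} f f≥0 = f≥0 []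
∑-nonneg {suc n} f f≥0 = ℤP.+-mono-≤ (∑-nonneg (f ↾ false) (λ x → f≥0 (false ∷ x)))
                                      (∑-nonneg (f ↾ true) (λ x → f≥0 (true ∷ x)))

nonneg-+-≡0 : ∀ {a b} → 0ℤ ≤ a → 0ℤ ≤ b → a + b ≡ 0ℤ → a ≡ 0ℤ × b ≡ 0ℤ
nonneg-+-≡0 {+ zero} {+ zero} _ _ _ = refl , refl
nonneg-+-≡0 {+ zero} {+ suc _} _ _ ()
nonneg-+-≡0 {+ suc _} {+ _} _ _ ()

∑-nonneg-≡0 : ∀ {n} (f : Cube n → ℤ) → (∀ x → 0ℤ ≤ f x) → ∑ f ≡ 0ℤ → ∀ x → f x ≡ 0ℤ
∑-nonneg-≡0 {zero} f f≥0 ∑f≡0 [] = ∑f≡0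
∑-nonneg-≡0 {suc n} f f≥0 ∑f≡0 (b ∷ x)
  with nonneg-+-≡0 (∑-nonneg (f ↾ false) (λ x → f≥0 (false ∷ x)))
                   (∑-nonneg (f ↾ true) (λ x → f≥0 (true ∷ x))) ∑f≡0
... | ∑₀≡0 , ∑₁≡0 with b
...   | false = ∑-nonneg-≡0 (f ↾ false) (λ x → f≥0 (false ∷ x)) ∑₀≡0 x
...   | true = ∑-nonneg-≡0 (f ↾ true) (λ x → f≥0 (true ∷ x)) ∑₁≡0 x

cubeSize : ℕ → ℤ
cubeSize n = + (2 ℕ.^ n)

cubeSize-suc : ∀ n → cubeSize (suc n) ≡ + 2 * cubeSize n
cubeSize-suc n = ℤP.pos-* 2 (2 ℕ.^ n)

-- χ u x = (-1)^(u · x)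
χ : ∀ {n} → Cube n → Cube n → ℤ
χ [] [] = 1ℤ
χ (false ∷ u) (_ ∷ x) = χ u x
χ (true ∷ u) (false ∷ x) = χ u x
χ (true ∷ u) (true ∷ x) = - χ u x

walsh : ∀ {n} → (Cube n → ℤ) → Cube n → ℤ
walsh f u = ∑ (λ x → f x * χ u x)

walsh-cong : ∀ {n} {f g : Cube n → ℤ} → (∀ x → f x ≡ g x) → ∀ u → walsh f u ≡ walsh g u
walsh-cong f≗g u = ∑-cong (λ x → cong (_* χ u x) (f≗g x))

walsh-+ : ∀ {n} (f g : Cube n → ℤ) u → walsh (λ x → f x + g x) u ≡ walsh f u + walsh g u
walsh-+ f g u = trans (∑-cong (λ x → ℤP.*-distribʳ-+ (χ u x) (f x) (g x)))
                      (∑-+ (λ x → f x * χ u x) (λ x → g x * χ u x))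

walsh-* : ∀ {n} (k : ℤ) (f : Cube n → ℤ) u → walsh (λ x → k * f x) u ≡ k * walsh f u
walsh-* k f u = trans (∑-cong (λ x → ℤP.*-assoc k (f x) (χ u x))) (∑-* k (λ x → f x * χ u x))

walsh-true : ∀ {n} (f : Cube (suc n) → ℤ) u →
             walsh f (true ∷ u) ≡ walsh (f ↾ false) u - walsh (f ↾ true) u
walsh-true f u = cong (_+_ (walsh (f ↾ false) u)) (begin
  ∑ (λ x → f (true ∷ x) * - χ u x)   ≡⟨ ∑-cong (λ x → sym (ℤP.neg-distribʳ-* (f (true ∷ x)) (χ u x))) ⟩
  ∑ (λ x → - (f (true ∷ x) * χ u x)) ≡⟨ ∑-neg (λ x → f (true ∷ x) * χ u x) ⟩
  - walsh (f ↾ true) u               ∎)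

parseval : ∀ {n} (f g : Cube n → ℤ) →
           ∑ (λ u → walsh f u * walsh g u) ≡ cubeSize n * ∑ (λ x → f x * g x)
parseval {zero} f g = solve₀ (f []) (g [])
  where
  solve₀ : ∀ a b → (a * 1ℤ) * (b * 1ℤ) ≡ 1ℤ * (a * b)
  solve₀ = solve-∀
parseval {suc n} f g = begin
  ∑ (λ u → walsh f (false ∷ u) * walsh g (false ∷ u)) + ∑ (λ u → walsh f (true ∷ u) * walsh g (true ∷ u))
    ≡⟨ cong (_+_ (∑ (λ u → (A u + B u) * (C u + D u))))
            (∑-cong (λ u → cong₂ _*_ (walsh-true f u) (walsh-true g u))) ⟩
  ∑ (λ u → (A u + B u) * (C u + D u)) + ∑ (λ u → (A u - B u) * (C u - D u))
    ≡⟨ sym (∑-+ (λ u → (A u + B u) * (C u + D u)) (λ u → (A u - B u) * (C u - D u))) ⟩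
  ∑ (λ u → (A u + B u) * (C u + D u) + (A u - B u) * (C u - D u))
    ≡⟨ ∑-cong (λ u → polarise (A u) (B u) (C u) (D u)) ⟩
  ∑ (λ u → + 2 * (A u * C u) + + 2 * (B u * D u))
    ≡⟨ ∑-lin (+ 2) (+ 2) (λ u → A u * C u) (λ u → B u * D u) ⟩
  + 2 * ∑ (λ u → A u * C u) + + 2 * ∑ (λ u → B u * D u)
    ≡⟨ cong₂ (λ p q → + 2 * p + + 2 * q) (parseval (f ↾ false) (g ↾ false)) (parseval (f ↾ true) (g ↾ true)) ⟩
  + 2 * (cubeSize n * ∑₀) + + 2 * (cubeSize n * ∑₁)
    ≡⟨ regroup (cubeSize n) ∑₀ ∑₁ ⟩
  (+ 2 * cubeSize n) * (∑₀ + ∑₁)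
    ≡⟨ cong (_* (∑₀ + ∑₁)) (sym (cubeSize-suc n)) ⟩
  cubeSize (suc n) * ∑ (λ x → f x * g x) ∎
  where
  A = walsh (f ↾ false)
  B = walsh (f ↾ true)
  C = walsh (g ↾ false)
  D = walsh (g ↾ true)
  ∑₀ = ∑ (λ x → f (false ∷ x) * g (false ∷ x))
  ∑₁ = ∑ (λ x → f (true ∷ x) * g (true ∷ x))
  polarise : ∀ a b c d → (a + b) * (c + d) + (a - b) * (c - d) ≡ + 2 * (a * c) + + 2 * (b * d)
  polarise = solve-∀
  regroup : ∀ p x y → + 2 * (p * x) + + 2 * (p * y) ≡ (+ 2 * p) * (x + y)
  regroup = solve-∀

δ₀ : ∀ {n} → Cube n → ℤ
δ₀ [] = 1ℤ
δ₀ (false ∷ u) = δ₀ u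
δ₀ (true ∷ u) = 0ℤ

δ₀-dichotomy : ∀ {n} (u : Cube n) → (δ₀ u ≡ 1ℤ × wt u ≡ 0) ⊎ (δ₀ u ≡ 0ℤ × 1 ℕ.≤ wt u)
δ₀-dichotomy [] = inj₁ (refl , refl)
δ₀-dichotomy (false ∷ u) = δ₀-dichotomy u
δ₀-dichotomy (true ∷ u) = inj₂ (refl , s≤s z≤n)

∑-χ : ∀ {n} (u : Cube n) → ∑ (χ u) ≡ cubeSize n * δ₀ u
∑-χ {zero} [] = refl
∑-χ {suc n} (false ∷ u) = begin
  ∑ (χ u) + ∑ (χ u)                   ≡⟨ cong₂ _+_ (∑-χ u) (∑-χ u) ⟩
  cubeSize n * δ₀ u + cubeSize n * δ₀ u ≡⟨ double (cubeSize n) (δ₀ u) ⟩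
  (+ 2 * cubeSize n) * δ₀ u           ≡⟨ cong (_* δ₀ u) (sym (cubeSize-suc n)) ⟩
  cubeSize (suc n) * δ₀ u             ∎
  where
  double : ∀ p z → p * z + p * z ≡ (+ 2 * p) * z
  double = solve-∀
∑-χ {suc n} (true ∷ u) = begin
  ∑ (χ u) + ∑ (λ x → - χ u x) ≡⟨ cong (_+_ (∑ (χ u))) (∑-neg (χ u)) ⟩
  ∑ (χ u) - ∑ (χ u)           ≡⟨ ℤP.+-inverseʳ (∑ (χ u)) ⟩
  0ℤ                          ≡⟨ sym (ℤP.*-zeroʳ (cubeSize (suc n))) ⟩
  cubeSize (suc n) * 0ℤ       ∎

walsh-const : ∀ {n} (k : ℤ) (u : Cube n) → walsh (λ _ → k) u ≡ k * (cubeSize n * δ₀ u)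
walsh-const k u = trans (∑-* k (χ u)) (cong (k *_) (∑-χ u))

walsh-const-off-0 : ∀ {n} (k : ℤ) (u : Cube n) → δ₀ u ≡ 0ℤ → walsh (λ _ → k) u ≡ 0ℤ
walsh-const-off-0 {n} k u δ₀u≡0 = begin
  walsh (λ _ → k) u         ≡⟨ walsh-const k u ⟩
  k * (cubeSize n * δ₀ u)   ≡⟨ cong (λ d → k * (cubeSize n * d)) δ₀u≡0 ⟩
  k * (cubeSize n * 0ℤ)     ≡⟨ cong (k *_) (ℤP.*-zeroʳ (cubeSize n)) ⟩
  k * 0ℤ                    ≡⟨ ℤP.*-zeroʳ k ⟩
  0ℤ                        ∎

χ-at-0 : ∀ {n} (u x : Cube n) → δ₀ u ≡ 1ℤ → χ u x ≡ 1ℤ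
χ-at-0 [] [] _ = refl
χ-at-0 (false ∷ u) (_ ∷ x) δ₀u≡1 = χ-at-0 u x δ₀u≡1
χ-at-0 (true ∷ u) (_ ∷ x) ()

walsh-at-0 : ∀ {n} (f : Cube n → ℤ) (u : Cube n) → δ₀ u ≡ 1ℤ → walsh f u ≡ ∑ f
walsh-at-0 f u δ₀u≡1 = ∑-cong (λ x → trans (cong (f x *_) (χ-at-0 u x δ₀u≡1)) (ℤP.*-identityʳ (f x)))

∑-δ₀ : ∀ {n} (h : Cube n → ℤ) → ∑ (λ u → δ₀ u * h u) ≡ h (replicate n false)
∑-δ₀ {zero} h = ℤP.*-identityˡ (h [])
∑-δ₀ {suc n} h = begin
  ∑ (λ u → δ₀ u * h (false ∷ u)) + ∑ (λ u → 0ℤ * h (true ∷ u))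
    ≡⟨ cong₂ _+_ (∑-δ₀ (h ↾ false)) (trans (∑-cong (λ u → ℤP.*-zeroˡ (h (true ∷ u)))) (∑-0 {n})) ⟩
  h (replicate (suc n) false) + 0ℤ
    ≡⟨ ℤP.+-identityʳ _ ⟩
  h (replicate (suc n) false) ∎

square-nonneg : ∀ a → 0ℤ ≤ a * a
square-nonneg (+ m) = subst (0ℤ ≤_) (ℤP.pos-* m m) (+≤+ z≤n)
square-nonneg -[1+ m ] = subst (0ℤ ≤_) (ℤP.pos-* (suc m) (suc m)) (+≤+ z≤n)

walsh-injective : ∀ {n} (g : Cube n → ℤ) → (∀ u → walsh g u ≡ 0ℤ) → ∀ x → g x ≡ 0ℤ
walsh-injective {n} g ĝ≡0 x =
  reduce (ℤP.i*j≡0⇒i≡0∨j≡0 (g x) (∑-nonneg-≡0 (λ x → g x * g x) (λ x → square-nonneg (g x)) ∑g²≡0 x))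
  where
  ∑g²≡0 : ∑ (λ x → g x * g x) ≡ 0ℤ
  ∑g²≡0 = ℤP.*-cancelˡ-≡ (cubeSize n) _ 0ℤ {{ℕP.m^n≢0 2 n}} (begin
    cubeSize n * ∑ (λ x → g x * g x)  ≡⟨ sym (parseval g g) ⟩
    ∑ (λ u → walsh g u * walsh g u)   ≡⟨ ∑-cong (λ u → cong (_* walsh g u) (ĝ≡0 u)) ⟩
    ∑ {n} (λ _ → 0ℤ)                  ≡⟨ ∑-0 {n} ⟩
    0ℤ                                ≡⟨ sym (ℤP.*-zeroʳ (cubeSize n)) ⟩
    cubeSize n * 0ℤ                   ∎)

walsh-supported-at-0⇒constant : ∀ {n} (h : Cube n → ℤ) → (∀ u → δ₀ u ≡ 0ℤ → walsh h u ≡ 0ℤ) →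
                                ∀ z z' → h z ≡ h z'
walsh-supported-at-0⇒constant {n} h ĥ≡0 z z' =
  ℤP.*-cancelˡ-≡ (cubeSize n) (h z) (h z') {{ℕP.m^n≢0 2 n}} (trans (scaled≡∑ z) (sym (scaled≡∑ z')))
  where
  -- the transform of h is concentrated at 0, hence equals that of the constant ∑ h / 2ⁿ
  g : Cube n → ℤ
  g x = cubeSize n * h x - ∑ h
  ĝ≡0 : ∀ u → walsh g u ≡ 0ℤ
  ĝ≡0 u = begin
    walsh g u
      ≡⟨ walsh-+ (λ x → cubeSize n * h x) (λ _ → - ∑ h) u ⟩
    walsh (λ x → cubeSize n * h x) u + walsh (λ _ → - ∑ h) u
      ≡⟨ cong₂ _+_ (walsh-* (cubeSize n) h u) (walsh-const (- ∑ h) u) ⟩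
    cubeSize n * walsh h u + (- ∑ h) * (cubeSize n * δ₀ u)
      ≡⟨ by-cases (δ₀-dichotomy u) ⟩
    0ℤ ∎
    where
    by-cases : _ → cubeSize n * walsh h u + (- ∑ h) * (cubeSize n * δ₀ u) ≡ 0ℤ
    by-cases (inj₁ (δ₀u≡1 , _)) rewrite δ₀u≡1 | walsh-at-0 h u δ₀u≡1 = cancel (cubeSize n) (∑ h)
      where
      cancel : ∀ p s → p * s + (- s) * (p * 1ℤ) ≡ 0ℤ
      cancel = solve-∀
    by-cases (inj₂ (δ₀u≡0 , _)) rewrite δ₀u≡0 | ĥ≡0 u δ₀u≡0 = vanish (cubeSize n) (∑ h)
      where
      vanish : ∀ p s → p * 0ℤ + (- s) * (p * 0ℤ) ≡ 0ℤ
      vanish = solve-∀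
  scaled≡∑ : ∀ x → cubeSize n * h x ≡ ∑ h
  scaled≡∑ x = ℤP.i-j≡0⇒i≡j _ _ (walsh-injective g ĝ≡0 x)

-- The adjacency operator

adj : ∀ {n} → (Cube n → ℤ) → Cube n → ℤ
adj {zero} f [] = 0ℤ
adj {suc n} f (b ∷ x) = f (not b ∷ x) + adj (f ↾ b) x

adj-cong : ∀ {n} {f g : Cube n → ℤ} → (∀ x → f x ≡ g x) → ∀ x → adj f x ≡ adj g x
adj-cong {zero} f≗g [] = refl
adj-cong {suc n} f≗g (b ∷ x) = cong₂ _+_ (f≗g (not b ∷ x)) (adj-cong (λ y → f≗g (b ∷ y)) x)

adj-+ : ∀ {n} (f g : Cube n → ℤ) x → adj (λ y → f y + g y) x ≡ adj f x + adj g x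
adj-+ {zero} f g [] = refl
adj-+ {suc n} f g (b ∷ x) = begin
  (f (not b ∷ x) + g (not b ∷ x)) + adj (λ y → f (b ∷ y) + g (b ∷ y)) x
    ≡⟨ cong (_+_ (f (not b ∷ x) + g (not b ∷ x))) (adj-+ (f ↾ b) (g ↾ b) x) ⟩
  (f (not b ∷ x) + g (not b ∷ x)) + (adj (f ↾ b) x + adj (g ↾ b) x)
    ≡⟨ interchange (f (not b ∷ x)) (g (not b ∷ x)) (adj (f ↾ b) x) (adj (g ↾ b) x) ⟩
  adj f (b ∷ x) + adj g (b ∷ x) ∎
  where
  interchange : ∀ a b c d → (a + b) + (c + d) ≡ (a + c) + (b + d)
  interchange = solve-∀

adj-1 : ∀ {n} (x : Cube n) → adj (λ _ → 1ℤ) x ≡ + n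
adj-1 [] = refl
adj-1 {suc n} (b ∷ x) = trans (cong (_+_ 1ℤ) (adj-1 x)) (sym (ℤP.pos-+ 1 n))

eigenvalue : ∀ {n} → Cube n → ℤ
eigenvalue {n} u = + n - + 2 * + wt u

walsh-adj : ∀ {n} (f : Cube n → ℤ) u → walsh (adj f) u ≡ eigenvalue u * walsh f u
walsh-adj {zero} f [] = refl
walsh-adj {suc n} f (false ∷ u) = begin
  walsh (λ x → f (true ∷ x) + adj f₀ x) u + walsh (λ x → f (false ∷ x) + adj f₁ x) u
    ≡⟨ cong₂ _+_ (walsh-+ f₁ (adj f₀) u) (walsh-+ f₀ (adj f₁) u) ⟩
  (walsh f₁ u + walsh (adj f₀) u) + (walsh f₀ u + walsh (adj f₁) u)
    ≡⟨ cong₂ _+_ (cong (_+_ (walsh f₁ u)) (walsh-adj f₀ u)) (cong (_+_ (walsh f₀ u)) (walsh-adj f₁ u)) ⟩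
  (walsh f₁ u + eigenvalue u * walsh f₀ u) + (walsh f₀ u + eigenvalue u * walsh f₁ u)
    ≡⟨ collect (+ n) (+ wt u) (walsh f₀ u) (walsh f₁ u) ⟩
  (1ℤ + + n - + 2 * + wt u) * (walsh f₀ u + walsh f₁ u)
    ≡⟨ cong (λ m → (m - + 2 * + wt u) * (walsh f₀ u + walsh f₁ u)) (sym (ℤP.pos-+ 1 n)) ⟩
  eigenvalue (false ∷ u) * walsh f (false ∷ u) ∎
  where
  f₀ = f ↾ false
  f₁ = f ↾ true
  collect : ∀ m w a b → (b + (m - + 2 * w) * a) + (a + (m - + 2 * w) * b) ≡ (1ℤ + m - + 2 * w) * (a + b)
  collect = solve-∀
walsh-adj {suc n} f (true ∷ u) = begin
  walsh (adj f) (true ∷ u)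
    ≡⟨ walsh-true (adj f) u ⟩
  walsh (λ x → f (true ∷ x) + adj f₀ x) u - walsh (λ x → f (false ∷ x) + adj f₁ x) u
    ≡⟨ cong₂ _-_ (walsh-+ f₁ (adj f₀) u) (walsh-+ f₀ (adj f₁) u) ⟩
  (walsh f₁ u + walsh (adj f₀) u) - (walsh f₀ u + walsh (adj f₁) u)
    ≡⟨ cong₂ _-_ (cong (_+_ (walsh f₁ u)) (walsh-adj f₀ u)) (cong (_+_ (walsh f₀ u)) (walsh-adj f₁ u)) ⟩
  (walsh f₁ u + eigenvalue u * walsh f₀ u) - (walsh f₀ u + eigenvalue u * walsh f₁ u)
    ≡⟨ collect (+ n) (+ wt u) (walsh f₀ u) (walsh f₁ u) ⟩
  (1ℤ + + n - + 2 * (1ℤ + + wt u)) * (walsh f₀ u - walsh f₁ u)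
    ≡⟨ cong₂ (λ m w → (m - + 2 * w) * (walsh f₀ u - walsh f₁ u))
             (sym (ℤP.pos-+ 1 n)) (sym (ℤP.pos-+ 1 (wt u))) ⟩
  eigenvalue (true ∷ u) * (walsh f₀ u - walsh f₁ u)
    ≡⟨ cong (eigenvalue (true ∷ u) *_) (sym (walsh-true f u)) ⟩
  eigenvalue (true ∷ u) * walsh f (true ∷ u) ∎
  where
  f₀ = f ↾ false
  f₁ = f ↾ true
  collect : ∀ m w a b → (b + (m - + 2 * w) * a) - (a + (m - + 2 * w) * b) ≡ (1ℤ + m - + 2 * (1ℤ + w)) * (a - b)
  collect = solve-∀

-- Face sums

-- faceSum f y z is the sum of f over the face E_y(z), of size faceSize y = 2^(n - wt y);
-- below u y is the indicator of u ≤ y coordinatewise.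
faceSum : ∀ {n} → (Cube n → ℤ) → Cube n → Cube n → ℤ
faceSum {zero} f [] [] = f []
faceSum {suc n} f (true ∷ y) (a ∷ z) = faceSum (f ↾ a) y z
faceSum {suc n} f (false ∷ y) (_ ∷ z) = faceSum (f ↾ false) y z + faceSum (f ↾ true) y z

below : ∀ {n} → Cube n → Cube n → ℤ
below [] [] = 1ℤ
below (true ∷ u) (false ∷ y) = 0ℤ
below (true ∷ u) (true ∷ y) = below u y
below (false ∷ u) (_ ∷ y) = below u y

faceSize : ∀ {n} → Cube n → ℤ
faceSize [] = 1ℤ
faceSize (false ∷ y) = + 2 * faceSize y
faceSize (true ∷ y) = faceSize y

walsh-faceSum : ∀ {n} (f : Cube n → ℤ) (y u : Cube n) →
                walsh (faceSum f y) u ≡ below u y * faceSize y * walsh f u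
walsh-faceSum {zero} f [] [] = solve₀ (f [])
  where
  solve₀ : ∀ a → a * 1ℤ ≡ 1ℤ * 1ℤ * (a * 1ℤ)
  solve₀ = solve-∀
walsh-faceSum {suc n} f (true ∷ y) (false ∷ u) =
  trans (cong₂ _+_ (walsh-faceSum (f ↾ false) y u) (walsh-faceSum (f ↾ true) y u))
        (sym (ℤP.*-distribˡ-+ (below u y * faceSize y) _ _))
walsh-faceSum {suc n} f (true ∷ y) (true ∷ u) = begin
  walsh (faceSum f (true ∷ y)) (true ∷ u)
    ≡⟨ walsh-true (faceSum f (true ∷ y)) u ⟩
  walsh (faceSum (f ↾ false) y) u - walsh (faceSum (f ↾ true) y) u
    ≡⟨ cong₂ _-_ (walsh-faceSum (f ↾ false) y u) (walsh-faceSum (f ↾ true) y u) ⟩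
  k * walsh (f ↾ false) u - k * walsh (f ↾ true) u
    ≡⟨ factor k (walsh (f ↾ false) u) (walsh (f ↾ true) u) ⟩
  k * (walsh (f ↾ false) u - walsh (f ↾ true) u)
    ≡⟨ cong (k *_) (sym (walsh-true f u)) ⟩
  k * walsh f (true ∷ u) ∎
  where
  k = below u y * faceSize y
  factor : ∀ k a b → k * a - k * b ≡ k * (a - b)
  factor = solve-∀
walsh-faceSum {suc n} f (false ∷ y) (false ∷ u) = begin
  walsh (λ z → faceSum f₀ y z + faceSum f₁ y z) u + walsh (λ z → faceSum f₀ y z + faceSum f₁ y z) u
    ≡⟨ cong₂ _+_ (walsh-+ (faceSum f₀ y) (faceSum f₁ y) u) (walsh-+ (faceSum f₀ y) (faceSum f₁ y) u) ⟩
  (walsh (faceSum f₀ y) u + walsh (faceSum f₁ y) u) + (walsh (faceSum f₀ y) u + walsh (faceSum f₁ y) u)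
    ≡⟨ cong (λ s → s + s) (cong₂ _+_ (walsh-faceSum f₀ y u) (walsh-faceSum f₁ y u)) ⟩
  (l * p * walsh f₀ u + l * p * walsh f₁ u) + (l * p * walsh f₀ u + l * p * walsh f₁ u)
    ≡⟨ collect l p (walsh f₀ u) (walsh f₁ u) ⟩
  l * (+ 2 * p) * (walsh f₀ u + walsh f₁ u) ∎
  where
  f₀ = f ↾ false
  f₁ = f ↾ true
  l = below u y
  p = faceSize y
  collect : ∀ l p a b → (l * p * a + l * p * b) + (l * p * a + l * p * b) ≡ l * (+ 2 * p) * (a + b)
  collect = solve-∀
walsh-faceSum {suc n} f (false ∷ y) (true ∷ u) = begin
  walsh (faceSum f (false ∷ y)) (true ∷ u)
    ≡⟨ walsh-true (faceSum f (false ∷ y)) u ⟩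
  walsh g u - walsh g u
    ≡⟨ ℤP.+-inverseʳ (walsh g u) ⟩
  0ℤ
    ≡⟨ sym (ℤP.*-zeroˡ (walsh f (true ∷ u))) ⟩
  0ℤ * walsh f (true ∷ u) ∎
  where
  g = λ z → faceSum (f ↾ false) y z + faceSum (f ↾ true) y z

faceSize≢0 : ∀ {n} (y : Cube n) → faceSize y ≢ 0ℤ
faceSize≢0 [] ()
faceSize≢0 (true ∷ y) = faceSize≢0 y
faceSize≢0 (false ∷ y) 2p≡0 with ℤP.i*j≡0⇒i≡0∨j≡0 (+ 2) 2p≡0
... | inj₂ p≡0 = faceSize≢0 y p≡0

below-0-or-1 : ∀ {n} (u y : Cube n) → below u y ≡ 0ℤ ⊎ below u y ≡ 1ℤ
below-0-or-1 [] [] = inj₂ refl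
below-0-or-1 (true ∷ u) (false ∷ y) = inj₁ refl
below-0-or-1 (true ∷ u) (true ∷ y) = below-0-or-1 u y
below-0-or-1 (false ∷ u) (_ ∷ y) = below-0-or-1 u y

constant-faceSums⇒walsh-vanishes : ∀ {n} (f : Cube n → ℤ) (y : Cube n) →
  (∀ z z' → faceSum f y z ≡ faceSum f y z') →
  ∀ u → δ₀ u ≡ 0ℤ → below u y ≡ 1ℤ → walsh f u ≡ 0ℤ
constant-faceSums⇒walsh-vanishes {n} f y constant u δ₀u≡0 u⊆y =
  reduce (map₁ (λ p≡0 → ⊥-elim (faceSize≢0 y p≡0)) (ℤP.i*j≡0⇒i≡0∨j≡0 (faceSize y) p*f̂≡0))
  where
  K = faceSum f y (replicate n false)
  p*f̂≡0 : faceSize y * walsh f u ≡ 0ℤ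
  p*f̂≡0 = begin
    faceSize y * walsh f u               ≡⟨ cong (_* walsh f u) (sym (ℤP.*-identityˡ (faceSize y))) ⟩
    1ℤ * faceSize y * walsh f u          ≡⟨ cong (λ l → l * faceSize y * walsh f u) (sym u⊆y) ⟩
    below u y * faceSize y * walsh f u   ≡⟨ sym (walsh-faceSum f y u) ⟩
    walsh (faceSum f y) u                ≡⟨ walsh-cong (λ z → constant z (replicate n false)) u ⟩
    walsh (λ _ → K) u                    ≡⟨ walsh-const-off-0 K u δ₀u≡0 ⟩
    0ℤ                                   ∎

walsh-vanishes⇒constant-faceSums : ∀ {n} (f : Cube n → ℤ) (y : Cube n) →
  (∀ u → δ₀ u ≡ 0ℤ → below u y ≡ 1ℤ → walsh f u ≡ 0ℤ) →
  ∀ z z' → faceSum f y z ≡ faceSum f y z'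
walsh-vanishes⇒constant-faceSums f y f̂≡0 = walsh-supported-at-0⇒constant (faceSum f y) vanishes
  where
  vanishes : ∀ u → δ₀ u ≡ 0ℤ → walsh (faceSum f y) u ≡ 0ℤ
  vanishes u δ₀u≡0 with below-0-or-1 u y
  ... | inj₁ u⊈y = trans (walsh-faceSum f y u) (cong (λ l → l * faceSize y * walsh f u) u⊈y)
  ... | inj₂ u⊆y = trans (walsh-faceSum f y u)
                         (trans (cong (below u y * faceSize y *_) (f̂≡0 u δ₀u≡0 u⊆y))
                                (ℤP.*-zeroʳ (below u y * faceSize y)))

below⇒wt≤ : ∀ {n} (u y : Cube n) → below u y ≡ 1ℤ → wt u ℕ.≤ wt y
below⇒wt≤ [] [] _ = z≤n
below⇒wt≤ (true ∷ u) (false ∷ y) ()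
below⇒wt≤ (true ∷ u) (true ∷ y) u⊆y = s≤s (below⇒wt≤ u y u⊆y)
below⇒wt≤ (false ∷ u) (false ∷ y) u⊆y = below⇒wt≤ u y u⊆y
below⇒wt≤ (false ∷ u) (true ∷ y) u⊆y = ℕP.m≤n⇒m≤1+n (below⇒wt≤ u y u⊆y)

wt≤n : ∀ {n} (u : Cube n) → wt u ℕ.≤ n
wt≤n [] = z≤n
wt≤n (true ∷ u) = s≤s (wt≤n u)
wt≤n (false ∷ u) = ℕP.m≤n⇒m≤1+n (wt≤n u)

superset-of-weight : ∀ {n} (u : Cube n) t → wt u ℕ.≤ t → t ℕ.≤ n →
                     Σ[ y ∈ Cube n ] below u y ≡ 1ℤ × wt y ≡ t
superset-of-weight [] zero _ _ = [] , refl , refl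
superset-of-weight (true ∷ u) (suc t) (s≤s wu≤t) (s≤s t≤n) with superset-of-weight u t wu≤t t≤n
... | y , u⊆y , wy≡t = true ∷ y , u⊆y , cong suc wy≡t
superset-of-weight {suc n} (false ∷ u) t wu≤t t≤1+n with t ℕ.≤? n
... | yes t≤n with superset-of-weight u t wu≤t t≤n
...   | y , u⊆y , wy≡t = false ∷ y , u⊆y , wy≡t
superset-of-weight {suc n} (false ∷ u) t wu≤t t≤1+n | no t≰n with superset-of-weight u n (wt≤n u) ℕP.≤-refl
...   | y , u⊆y , wy≡n = true ∷ y , u⊆y , trans (cong suc wy≡n) (ℕP.≤-antisym (ℕP.≰⇒> t≰n) t≤1+n)

-- The list-based definitions as cube sums

ind : Bool → ℤ
ind true = 1ℤ
ind false = 0ℤ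

sumL-++ : ∀ {A : Set} (f : A → ℕ) xs ys → sumL f (xs ++ ys) ≡ sumL f xs ℕ.+ sumL f ys
sumL-++ f [] ys = refl
sumL-++ f (x ∷ xs) ys = trans (cong (f x ℕ.+_) (sumL-++ f xs ys)) (sym (ℕP.+-assoc (f x) _ _))

sumL-map : ∀ {A B : Set} (f : B → ℕ) (g : A → B) xs → sumL f (map g xs) ≡ sumL (λ x → f (g x)) xs
sumL-map f g [] = refl
sumL-map f g (x ∷ xs) = cong (f (g x) ℕ.+_) (sumL-map f g xs)

sumL-allVecs : ∀ {n} (f : Cube n → ℕ) → + sumL f (allVecs n) ≡ ∑ (λ x → + f x)
sumL-allVecs {zero} f = cong +_ (ℕP.+-identityʳ (f []))
sumL-allVecs {suc n} f = begin
  + sumL f (map (false ∷_) (allVecs n) ++ map (true ∷_) (allVecs n))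
    ≡⟨ cong +_ (sumL-++ f (map (false ∷_) (allVecs n)) (map (true ∷_) (allVecs n))) ⟩
  + (sumL f (map (false ∷_) (allVecs n)) ℕ.+ sumL f (map (true ∷_) (allVecs n)))
    ≡⟨ ℤP.pos-+ (sumL f (map (false ∷_) (allVecs n))) (sumL f (map (true ∷_) (allVecs n))) ⟩
  + sumL f (map (false ∷_) (allVecs n)) + + sumL f (map (true ∷_) (allVecs n))
    ≡⟨ cong₂ (λ a b → + a + + b) (sumL-map f (false ∷_) (allVecs n)) (sumL-map f (true ∷_) (allVecs n)) ⟩
  + sumL (f ↾ false) (allVecs n) + + sumL (f ↾ true) (allVecs n)
    ≡⟨ cong₂ _+_ (sumL-allVecs (f ↾ false)) (sumL-allVecs (f ↾ true)) ⟩
  ∑ (λ x → + f x) ∎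

countTrue-allVecs : ∀ {n} (p : Cube n → Bool) → + countTrue p (allVecs n) ≡ ∑ (λ x → ind (p x))
countTrue-allVecs {n} p = begin
  + countTrue p (allVecs n)                          ≡⟨ cong +_ (as-sum (allVecs n)) ⟩
  + sumL (λ x → if p x then 1 else 0) (allVecs n)    ≡⟨ sumL-allVecs (λ x → if p x then 1 else 0) ⟩
  ∑ (λ x → + (if p x then 1 else 0))                 ≡⟨ ∑-cong (λ x → ind-if (p x)) ⟩
  ∑ (λ x → ind (p x))                                ∎
  where
  as-sum : ∀ xs → countTrue p xs ≡ sumL (λ x → if p x then 1 else 0) xs
  as-sum [] = refl
  as-sum (x ∷ xs) = cong ((if p x then 1 else 0) ℕ.+_) (as-sum xs)
  ind-if : ∀ b → + (if b then 1 else 0) ≡ ind b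
  ind-if true = refl
  ind-if false = refl

allVecs-complete : ∀ {n} (x : Cube n) → x ∈ allVecs n
allVecs-complete [] = here refl
allVecs-complete {suc n} (false ∷ x) = ∈-++⁺ˡ (∈-map⁺ (false ∷_) (allVecs-complete x))
allVecs-complete {suc n} (true ∷ x) = ∈-++⁺ʳ (map (false ∷_) (allVecs n)) (∈-map⁺ (true ∷_) (allVecs-complete x))

countTrue-pos : ∀ {A : Set} (p : A → Bool) {xs x} → x ∈ xs → p x ≡ true → 0 ℕ.< countTrue p xs
countTrue-pos p {x ∷ _} (here refl) px≡true rewrite px≡true = s≤s z≤n
countTrue-pos p {y ∷ xs} (there x∈xs) px≡true =
  ℕP.≤-trans (countTrue-pos p x∈xs px≡true) (ℕP.m≤n+m (countTrue p xs) (if p y then 1 else 0))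

∑-dist≡0 : ∀ {n} (p : Cube n → Bool) x → ∑ (λ y → ind ((dist x y ≡ᵇ 0) ∧ p y)) ≡ ind (p x)
∑-dist≡0 {zero} p [] = refl
∑-dist≡0 {suc n} p (false ∷ x) =
  trans (cong (_+_ (∑ (λ y → ind ((dist x y ≡ᵇ 0) ∧ p (false ∷ y))))) (∑-0 {n}))
        (trans (ℤP.+-identityʳ _) (∑-dist≡0 (p ↾ false) x))
∑-dist≡0 {suc n} p (true ∷ x) =
  trans (cong (_+ ∑ (λ y → ind ((dist x y ≡ᵇ 0) ∧ p (true ∷ y)))) (∑-0 {n}))
        (trans (ℤP.+-identityˡ _) (∑-dist≡0 (p ↾ true) x))

∑-dist≡1 : ∀ {n} (p : Cube n → Bool) x → ∑ (λ y → ind ((dist x y ≡ᵇ 1) ∧ p y)) ≡ adj (λ y → ind (p y)) x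
∑-dist≡1 {zero} p [] = refl
∑-dist≡1 {suc n} p (false ∷ x) =
  trans (cong₂ _+_ (∑-dist≡1 (p ↾ false) x) (∑-dist≡0 (p ↾ true) x))
        (ℤP.+-comm (adj (λ y → ind (p (false ∷ y))) x) (ind (p (true ∷ x))))
∑-dist≡1 {suc n} p (true ∷ x) = cong₂ _+_ (∑-dist≡0 (p ↾ false) x) (∑-dist≡1 (p ↾ true) x)

∑-ball : ∀ {n} (p : Cube n → Bool) x →
         ∑ (λ y → ind (p y ∧ (dist x y ≤ᵇ 1))) ≡ ind (p x) + adj (λ y → ind (p y)) x
∑-ball p x = begin
  ∑ (λ y → ind (p y ∧ (dist x y ≤ᵇ 1)))
    ≡⟨ ∑-cong (λ y → split (p y) (dist x y)) ⟩
  ∑ (λ y → ind ((dist x y ≡ᵇ 0) ∧ p y) + ind ((dist x y ≡ᵇ 1) ∧ p y))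
    ≡⟨ ∑-+ (λ y → ind ((dist x y ≡ᵇ 0) ∧ p y)) (λ y → ind ((dist x y ≡ᵇ 1) ∧ p y)) ⟩
  ∑ (λ y → ind ((dist x y ≡ᵇ 0) ∧ p y)) + ∑ (λ y → ind ((dist x y ≡ᵇ 1) ∧ p y))
    ≡⟨ cong₂ _+_ (∑-dist≡0 p x) (∑-dist≡1 p x) ⟩
  ind (p x) + adj (λ y → ind (p y)) x ∎
  where
  split : ∀ b d → ind (b ∧ (d ≤ᵇ 1)) ≡ ind ((d ≡ᵇ 0) ∧ b) + ind ((d ≡ᵇ 1) ∧ b)
  split false zero = refl
  split false (suc zero) = refl
  split false (suc (suc d)) = refl
  split true zero = refl
  split true (suc zero) = refl
  split true (suc (suc d)) = refl

∑-face : ∀ {n} (p : Cube n → Bool) y z → ∑ (λ x → ind (inFace y z x ∧ p x)) ≡ faceSum (λ x → ind (p x)) y z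
∑-face {zero} p [] [] = refl
∑-face {suc n} p (true ∷ y) (false ∷ z) =
  trans (cong (_+_ (∑ (λ x → ind (inFace y z x ∧ p (false ∷ x))))) (∑-0 {n}))
        (trans (ℤP.+-identityʳ _) (∑-face (p ↾ false) y z))
∑-face {suc n} p (true ∷ y) (true ∷ z) =
  trans (cong (_+ ∑ (λ x → ind (inFace y z x ∧ p (true ∷ x)))) (∑-0 {n}))
        (trans (ℤP.+-identityˡ _) (∑-face (p ↾ true) y z))
∑-face {suc n} p (false ∷ y) (false ∷ z) = cong₂ _+_ (∑-face (p ↾ false) y z) (∑-face (p ↾ true) y z)
∑-face {suc n} p (false ∷ y) (true ∷ z) = cong₂ _+_ (∑-face (p ↾ false) y z) (∑-face (p ↾ true) y z)

-- Correlation immunity and perfect colourings in the spectrum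

indicator : ∀ {n} → Subset n → Cube n → ℤ
indicator S x = ind (S x)

indicator-idempotent : ∀ {n} (S : Subset n) x → indicator S x * indicator S x ≡ indicator S x
indicator-idempotent S x with S x
... | true = refl
... | false = refl

sumL-ballCount : ∀ {n} (S : Subset n) →
  + sumL (λ x → if S x then ballCount S x else 0) (allVecs n) ≡
  ∑ (indicator S) + ∑ (λ x → indicator S x * adj (indicator S) x)
sumL-ballCount {n} S = begin
  + sumL (λ x → if S x then ballCount S x else 0) (allVecs n)
    ≡⟨ sumL-allVecs (λ x → if S x then ballCount S x else 0) ⟩
  ∑ (λ x → + (if S x then ballCount S x else 0))
    ≡⟨ ∑-cong (λ x → trans (gate (S x) (ballCount S x)) (cong (f x *_) (ball x))) ⟩
  ∑ (λ x → f x * (f x + adj f x))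
    ≡⟨ ∑-cong (λ x → trans (ℤP.*-distribˡ-+ (f x) (f x) (adj f x))
                           (cong (_+ f x * adj f x) (indicator-idempotent S x))) ⟩
  ∑ (λ x → f x + f x * adj f x)
    ≡⟨ ∑-+ f (λ x → f x * adj f x) ⟩
  ∑ f + ∑ (λ x → f x * adj f x) ∎
  where
  f = indicator S
  gate : ∀ b k → + (if b then k else 0) ≡ ind b * + k
  gate true k = sym (ℤP.*-identityˡ (+ k))
  gate false k = refl
  ball : ∀ x → + ballCount S x ≡ f x + adj f x
  ball x = trans (countTrue-allVecs (λ y → S y ∧ (dist x y ≤ᵇ 1))) (∑-ball S x)

SpectrumVanishesUpTo : ∀ {n} → (Cube n → ℤ) → ℕ → Set
SpectrumVanishesUpTo f t = ∀ u → δ₀ u ≡ 0ℤ → wt u ℕ.≤ t → walsh f u ≡ 0ℤ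

faceCount≡faceSum : ∀ {n} (S : Subset n) y z → + faceCount S y z ≡ faceSum (indicator S) y z
faceCount≡faceSum S y z = trans (countTrue-allVecs (λ x → inFace y z x ∧ S x)) (∑-face S y z)

corrImmune⇒spectrum-vanishes : ∀ {n} (S : Subset n) t → t ℕ.≤ n → CorrImmune S t →
                               SpectrumVanishesUpTo (indicator S) t
corrImmune⇒spectrum-vanishes S t t≤n immune u δ₀u≡0 wu≤t with superset-of-weight u t wu≤t t≤n
... | y , u⊆y , wy≡t = constant-faceSums⇒walsh-vanishes (indicator S) y constant u δ₀u≡0 u⊆y
  where
  constant : ∀ z z' → faceSum (indicator S) y z ≡ faceSum (indicator S) y z'
  constant z z' = trans (sym (faceCount≡faceSum S y z))
                        (trans (cong +_ (immune y wy≡t z z')) (faceCount≡faceSum S y z'))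

spectrum-vanishes⇒corrImmune : ∀ {n} (S : Subset n) t → SpectrumVanishesUpTo (indicator S) t →
                               CorrImmune S t
spectrum-vanishes⇒corrImmune S t vanishes y wy≡t z z' = ℤP.+-injective (begin
  + faceCount S y z               ≡⟨ faceCount≡faceSum S y z ⟩
  faceSum (indicator S) y z       ≡⟨ walsh-vanishes⇒constant-faceSums (indicator S) y vanishes-below-y z z' ⟩
  faceSum (indicator S) y z'      ≡⟨ sym (faceCount≡faceSum S y z') ⟩
  + faceCount S y z'              ∎)
  where
  vanishes-below-y : ∀ u → δ₀ u ≡ 0ℤ → below u y ≡ 1ℤ → walsh (indicator S) u ≡ 0ℤ
  vanishes-below-y u δ₀u≡0 u⊆y = vanishes u δ₀u≡0 (subst (wt u ℕ.≤_) wy≡t (below⇒wt≤ u y u⊆y))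

perfect-if-neighbourhoods-agree : ∀ {n} (Col : Cube n → Bool) →
  (∀ x x' → Col x ≡ Col x' → ∀ j → nbColour Col x j ≡ nbColour Col x' j) → PerfectColouring Col
perfect-if-neighbourhoods-agree {n} Col agree = counts , counts-correct
  where
  counts : Bool → Bool → ℕ
  counts b j with any? (λ y → Col y Bool.≟ b) (allVecs n)
  ... | yes found = nbColour Col (proj₁ (satisfied found)) j
  ... | no _ = 0
  counts-correct : ∀ x j → nbColour Col x j ≡ counts (Col x) j
  counts-correct x j with any? (λ y → Col y Bool.≟ Col x) (allVecs n)
  ... | yes found = agree x _ (sym (proj₂ (satisfied found))) j
  ... | no none = ⊥-elim (none (lose (allVecs-complete x) refl))

nbColour-true : ∀ {n} (S : Subset n) x → + nbColour S x true ≡ adj (indicator S) x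
nbColour-true S x = begin
  + nbColour S x true
    ≡⟨ countTrue-allVecs (λ y → (dist x y ≡ᵇ 1) ∧ (if S y then true else false)) ⟩
  ∑ (λ y → ind ((dist x y ≡ᵇ 1) ∧ (if S y then true else false)))
    ≡⟨ ∑-dist≡1 (λ y → if S y then true else false) x ⟩
  adj (λ y → ind (if S y then true else false)) x
    ≡⟨ adj-cong (λ y → same (S y)) x ⟩
  adj (indicator S) x ∎
  where
  same : ∀ b → ind (if b then true else false) ≡ ind b
  same true = refl
  same false = refl

nbColour-false : ∀ {n} (S : Subset n) x → + nbColour S x false + adj (indicator S) x ≡ + n
nbColour-false {n} S x = begin
  + nbColour S x false + adj (indicator S) x
    ≡⟨ cong (_+ adj (indicator S) x) (countTrue-allVecs (λ y → (dist x y ≡ᵇ 1) ∧ (if S y then false else true))) ⟩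
  ∑ (λ y → ind ((dist x y ≡ᵇ 1) ∧ (if S y then false else true))) + adj (indicator S) x
    ≡⟨ cong (_+ adj (indicator S) x) (∑-dist≡1 (λ y → if S y then false else true) x) ⟩
  adj (λ y → ind (if S y then false else true)) x + adj (indicator S) x
    ≡⟨ sym (adj-+ (λ y → ind (if S y then false else true)) (indicator S) x) ⟩
  adj (λ y → ind (if S y then false else true) + ind (S y)) x
    ≡⟨ adj-cong (λ y → complementary (S y)) x ⟩
  adj (λ _ → 1ℤ) x
    ≡⟨ adj-1 x ⟩
  + n ∎
  where
  complementary : ∀ b → ind (if b then false else true) + ind b ≡ 1ℤ
  complementary true = refl
  complementary false = refl

adj-determines-nbColour : ∀ {n} (S : Subset n) x x' → adj (indicator S) x ≡ adj (indicator S) x' →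
                          ∀ j → nbColour S x j ≡ nbColour S x' j
adj-determines-nbColour S x x' same true =
  ℤP.+-injective (trans (nbColour-true S x) (trans same (sym (nbColour-true S x'))))
adj-determines-nbColour {n} S x x' same false = ℤP.+-injective (begin
  + nbColour S x false
    ≡⟨ isolate (+ nbColour S x false) (adj (indicator S) x) ⟩
  (+ nbColour S x false + adj (indicator S) x) - adj (indicator S) x
    ≡⟨ cong₂ _-_ (trans (nbColour-false S x) (sym (nbColour-false S x'))) same ⟩
  (+ nbColour S x' false + adj (indicator S) x') - adj (indicator S) x'
    ≡⟨ sym (isolate (+ nbColour S x' false) (adj (indicator S) x')) ⟩
  + nbColour S x' false ∎)
  where
  isolate : ∀ a b → a ≡ (a + b) - b
  isolate = solve-∀

eigenvalue-injective : ∀ {n} (u v : Cube n) → eigenvalue u ≡ eigenvalue v → wt u ≡ wt v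
eigenvalue-injective {n} u v eu≡ev =
  ℤP.+-injective (ℤP.*-cancelˡ-≡ (+ 2) (+ wt u) (+ wt v) (begin
    + 2 * + wt u                  ≡⟨ recover (+ n) (+ 2 * + wt u) ⟩
    + n - eigenvalue u            ≡⟨ cong (_-_ (+ n)) eu≡ev ⟩
    + n - eigenvalue v            ≡⟨ sym (recover (+ n) (+ 2 * + wt v)) ⟩
    + 2 * + wt v                  ∎))
  where
  recover : ∀ m x → x ≡ m - (m - x)
  recover = solve-∀

OneEigenvalue : ∀ {n} → (Cube n → ℤ) → Set
OneEigenvalue f = Σ[ μ ∈ ℤ ] ∀ u → δ₀ u ≡ 0ℤ → walsh f u ≡ 0ℤ ⊎ eigenvalue u ≡ μ

SpectrumOnLevel : ∀ {n} → (Cube n → ℤ) → ℕ → Set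
SpectrumOnLevel f w = ∀ u → δ₀ u ≡ 0ℤ → walsh f u ≡ 0ℤ ⊎ wt u ≡ w

perfect⇒oneEigenvalue : ∀ {n} (S : Subset n) → PerfectColouring S → OneEigenvalue (indicator S)
perfect⇒oneEigenvalue S (a , regular) = A - B , zero-or-μ
  where
  f = indicator S
  A = + a true true
  B = + a false true
  adj-affine : ∀ x → adj f x ≡ (A - B) * f x + B
  adj-affine x = trans (sym (nbColour-true S x)) (trans (cong +_ (regular x true)) (by-colour (S x)))
    where
    by-colour : ∀ b → + a b true ≡ (A - B) * ind b + B
    by-colour true = solve₁ A B
      where
      solve₁ : ∀ a b → a ≡ (a - b) * 1ℤ + b
      solve₁ = solve-∀
    by-colour false = solve₀ A B
      where
      solve₀ : ∀ a b → b ≡ (a - b) * 0ℤ + b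
      solve₀ = solve-∀
  zero-or-μ : ∀ u → δ₀ u ≡ 0ℤ → walsh f u ≡ 0ℤ ⊎ eigenvalue u ≡ A - B
  zero-or-μ u δ₀u≡0 with ℤP.i*j≡0⇒i≡0∨j≡0 (eigenvalue u - (A - B)) (begin
      (eigenvalue u - (A - B)) * walsh f u
        ≡⟨ expand (eigenvalue u) (A - B) (walsh f u) ⟩
      eigenvalue u * walsh f u - (A - B) * walsh f u
        ≡⟨ cong (_- (A - B) * walsh f u) (sym (walsh-adj f u)) ⟩
      walsh (adj f) u - (A - B) * walsh f u
        ≡⟨ cong (_- (A - B) * walsh f u) (walsh-cong adj-affine u) ⟩
      walsh (λ x → (A - B) * f x + B) u - (A - B) * walsh f u
        ≡⟨ cong (_- (A - B) * walsh f u) (walsh-+ (λ x → (A - B) * f x) (λ _ → B) u) ⟩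
      (walsh (λ x → (A - B) * f x) u + walsh (λ _ → B) u) - (A - B) * walsh f u
        ≡⟨ cong₂ (λ p q → (p + q) - (A - B) * walsh f u) (walsh-* (A - B) f u) (walsh-const-off-0 B u δ₀u≡0) ⟩
      ((A - B) * walsh f u + 0ℤ) - (A - B) * walsh f u
        ≡⟨ cancel ((A - B) * walsh f u) ⟩
      0ℤ ∎)
    where
    expand : ∀ e m w → (e - m) * w ≡ e * w - m * w
    expand = solve-∀
    cancel : ∀ p → (p + 0ℤ) - p ≡ 0ℤ
    cancel = solve-∀
  ... | inj₁ e-μ≡0 = inj₂ (ℤP.i-j≡0⇒i≡j _ _ e-μ≡0)
  ... | inj₂ f̂u≡0 = inj₁ f̂u≡0

oneEigenvalue⇒spectrumOnLevel : ∀ {n} (S : Subset n) c → IsCor S c → OneEigenvalue (indicator S) →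
                                SpectrumOnLevel (indicator S) (suc c)
oneEigenvalue⇒spectrumOnLevel S c (c≤n , immune , maximal) (μ , zero-or-μ) u δ₀u≡0
  with walsh (indicator S) u ℤP.≟ 0ℤ
... | yes f̂u≡0 = inj₁ f̂u≡0
... | no f̂u≢0 = inj₂ (ℕP.≤-antisym (upper (wt u) refl) lower)
  where
  eu≡μ : eigenvalue u ≡ μ
  eu≡μ with zero-or-μ u δ₀u≡0
  ... | inj₁ f̂u≡0 = ⊥-elim (f̂u≢0 f̂u≡0)
  ... | inj₂ eu≡μ = eu≡μ
  lower : suc c ℕ.≤ wt u
  lower with wt u ℕ.≤? c
  ... | yes wu≤c = ⊥-elim (f̂u≢0 (corrImmune⇒spectrum-vanishes S c c≤n immune u δ₀u≡0 wu≤c))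
  ... | no wu≰c = ℕP.≰⇒> wu≰c
  -- every other nonzero coefficient sits on the level of u, so below it the spectrum vanishes
  vanishes-below : ∀ m → wt u ≡ suc m → SpectrumVanishesUpTo (indicator S) m
  vanishes-below m wu≡1+m v δ₀v≡0 wv≤m with zero-or-μ v δ₀v≡0
  ... | inj₁ f̂v≡0 = f̂v≡0
  ... | inj₂ ev≡μ = ⊥-elim (ℕP.<⇒≱ (s≤s wv≤m)
                     (ℕP.≤-reflexive (trans wu≡1+m' (eigenvalue-injective u v (trans eu≡μ (sym ev≡μ))))))
    where
    wu≡1+m' = sym wu≡1+m
  upper : ∀ w → wt u ≡ w → w ℕ.≤ suc c
  upper zero wu≡0 = ⊥-elim (ℕP.<⇒≱ (ℕP.≤-trans lower (ℕP.≤-reflexive wu≡0)) z≤n)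
  upper (suc m) wu≡1+m =
    s≤s (maximal m (ℕP.<⇒≤ (ℕP.≤-trans (ℕP.≤-reflexive (sym wu≡1+m)) (wt≤n u)))
                   (spectrum-vanishes⇒corrImmune S m (vanishes-below m wu≡1+m)))

spectrumOnLevel⇒perfect : ∀ {n} (S : Subset n) w → SpectrumOnLevel (indicator S) w → PerfectColouring S
spectrumOnLevel⇒perfect {n} S w on-level =
  perfect-if-neighbourhoods-agree S (λ x x' Sx≡Sx' → adj-determines-nbColour S x x' (adj-agrees x x' Sx≡Sx'))
  where
  f = indicator S
  λw = + n - + 2 * + w
  h : Cube n → ℤ
  h x = adj f x + (- λw) * f x
  ĥ≡0 : ∀ u → δ₀ u ≡ 0ℤ → walsh h u ≡ 0ℤ
  ĥ≡0 u δ₀u≡0 = begin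
    walsh h u                                   ≡⟨ walsh-+ (adj f) (λ x → (- λw) * f x) u ⟩
    walsh (adj f) u + walsh (λ x → (- λw) * f x) u ≡⟨ cong₂ _+_ (walsh-adj f u) (walsh-* (- λw) f u) ⟩
    eigenvalue u * walsh f u + (- λw) * walsh f u ≡⟨ factor (eigenvalue u) λw (walsh f u) ⟩
    (eigenvalue u - λw) * walsh f u             ≡⟨ off-level (on-level u δ₀u≡0) ⟩
    0ℤ                                          ∎
    where
    factor : ∀ e l a → e * a + (- l) * a ≡ (e - l) * a
    factor = solve-∀
    off-level : walsh f u ≡ 0ℤ ⊎ wt u ≡ w → (eigenvalue u - λw) * walsh f u ≡ 0ℤ
    off-level (inj₁ f̂u≡0) = trans (cong ((eigenvalue u - λw) *_) f̂u≡0) (ℤP.*-zeroʳ (eigenvalue u - λw))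
    off-level (inj₂ wu≡w) = trans (cong (λ k → (+ n - + 2 * + k - λw) * walsh f u) wu≡w)
                                  (trans (cong (_* walsh f u) (ℤP.+-inverseʳ λw)) (ℤP.*-zeroˡ (walsh f u)))
  restore : ∀ x → adj f x ≡ h x + λw * f x
  restore x = solve₀ (adj f x) λw (f x)
    where
    solve₀ : ∀ a l b → a ≡ (a + (- l) * b) + l * b
    solve₀ = solve-∀
  adj-agrees : ∀ x x' → S x ≡ S x' → adj f x ≡ adj f x'
  adj-agrees x x' Sx≡Sx' = begin
    adj f x             ≡⟨ restore x ⟩
    h x + λw * f x      ≡⟨ cong₂ _+_ (walsh-supported-at-0⇒constant h ĥ≡0 x x')
                                     (cong (λ b → λw * ind b) Sx≡Sx') ⟩
    h x' + λw * f x'    ≡⟨ sym (restore x') ⟩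
    adj f x'            ∎

perfect⇔spectrumOnLevel : ∀ {n} (S : Subset n) c → IsCor S c →
                          PerfectColouring S ⇔ SpectrumOnLevel (indicator S) (suc c)
perfect⇔spectrumOnLevel S c cor =
  mk⇔ (λ perfect → oneEigenvalue⇒spectrumOnLevel S c cor (perfect⇒oneEigenvalue S perfect))
      (spectrumOnLevel⇒perfect S (suc c))

-- The energy identity

-- With B = Σ_{x ∈ S} |B(x) ∩ S|, s = |S|, N = 2ⁿ and C = cor(S) + 1 this is
-- N s (n − nei(S) − 2 C (1 − ρ(S))), the slack in the inequality of the theorem.
excess : ℤ → ℤ → ℤ → ℤ → ℤ → ℤ
excess n B s N C = n * N * s - N * (B - s) - + 2 * C * N * s + + 2 * C * (s * s)

excessOf : ∀ {n} → (Cube n → ℤ) → ℕ → ℤ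
excessOf {n} f c = excess (+ n) (∑ f + ∑ (λ x → f x * adj f x)) (∑ f) (cubeSize n) (+ suc c)

product-nonneg : ∀ a b → 0ℤ ≤ a → 0ℤ ≤ b → 0ℤ ≤ a * b
product-nonneg (+ m) (+ k) _ _ = subst (0ℤ ≤_) (ℤP.pos-* m k) (+≤+ z≤n)

module _ {n : ℕ} (f : Cube n → ℤ) (idempotent : ∀ x → f x * f x ≡ f x) (c : ℕ) where

  private
    N = cubeSize n
    s = ∑ f
    E = ∑ (λ x → f x * adj f x)
    C = + suc c
    Q : Cube n → ℤ
    Q u = walsh f u * walsh f u

  -- (wt u − c − 1) f̂(u)² for u ≠ 0, and 0 at u = 0
  defect : Cube n → ℤ
  defect u = (+ wt u - C) * Q u + C * (δ₀ u * Q u)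

  energy-identity : + 2 * ∑ defect ≡ excessOf f c
  energy-identity = begin
    + 2 * ∑ defect
      ≡⟨ sym (∑-* (+ 2) defect) ⟩
    ∑ (λ u → + 2 * defect u)
      ≡⟨ ∑-cong (λ u → spectral-form (+ n) (+ wt u) C (δ₀ u) (Q u)) ⟩
    ∑ (λ u → (+ n - + 2 * C) * Q u + (-1ℤ * (eigenvalue u * Q u) + + 2 * C * (δ₀ u * Q u)))
      ≡⟨ ∑-+ (λ u → (+ n - + 2 * C) * Q u) (λ u → -1ℤ * (eigenvalue u * Q u) + + 2 * C * (δ₀ u * Q u)) ⟩
    ∑ (λ u → (+ n - + 2 * C) * Q u) + ∑ (λ u → -1ℤ * (eigenvalue u * Q u) + + 2 * C * (δ₀ u * Q u))
      ≡⟨ cong₂ _+_ (∑-* (+ n - + 2 * C) Q)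
                   (∑-lin -1ℤ (+ 2 * C) (λ u → eigenvalue u * Q u) (λ u → δ₀ u * Q u)) ⟩
    (+ n - + 2 * C) * ∑ Q + (-1ℤ * ∑ (λ u → eigenvalue u * Q u) + + 2 * C * ∑ (λ u → δ₀ u * Q u))
      ≡⟨ cong₂ (λ p q → (+ n - + 2 * C) * p + (-1ℤ * q + + 2 * C * ∑ (λ u → δ₀ u * Q u)))
               ∑Q ∑eigenvalue·Q ⟩
    (+ n - + 2 * C) * (N * s) + (-1ℤ * (N * E) + + 2 * C * ∑ (λ u → δ₀ u * Q u))
      ≡⟨ cong (λ p → (+ n - + 2 * C) * (N * s) + (-1ℤ * (N * E) + + 2 * C * p)) ∑δ₀·Q ⟩
    (+ n - + 2 * C) * (N * s) + (-1ℤ * (N * E) + + 2 * C * (s * s))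
      ≡⟨ rearrange (+ n) s E N C ⟩
    excess (+ n) (s + E) s N C ∎
    where
    spectral-form : ∀ m w c z q → + 2 * ((w - c) * q + c * (z * q)) ≡
                    (m - + 2 * c) * q + (-1ℤ * ((m - + 2 * w) * q) + + 2 * c * (z * q))
    spectral-form = solve-∀
    rearrange : ∀ m s E N c → (m - + 2 * c) * (N * s) + (-1ℤ * (N * E) + + 2 * c * (s * s)) ≡
                m * N * s - N * ((s + E) - s) - + 2 * c * N * s + + 2 * c * (s * s)
    rearrange = solve-∀
    ∑Q : ∑ Q ≡ N * s
    ∑Q = trans (parseval f f) (cong (N *_) (∑-cong idempotent))
    ∑eigenvalue·Q : ∑ (λ u → eigenvalue u * Q u) ≡ N * E
    ∑eigenvalue·Q = trans (∑-cong (λ u → trans (swap (eigenvalue u) (walsh f u))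
                                               (cong (walsh f u *_) (sym (walsh-adj f u)))))
                          (parseval f (adj f))
      where
      swap : ∀ l a → l * (a * a) ≡ a * (l * a)
      swap = solve-∀
    ∑δ₀·Q : ∑ (λ u → δ₀ u * Q u) ≡ s * s
    ∑δ₀·Q = trans (∑-δ₀ Q) (cong₂ _*_ (walsh-at-0 f 0⃗ (δ₀-0⃗ n)) (walsh-at-0 f 0⃗ (δ₀-0⃗ n)))
      where
      0⃗ = replicate n false
      δ₀-0⃗ : ∀ m → δ₀ (replicate m false) ≡ 1ℤ
      δ₀-0⃗ zero = refl
      δ₀-0⃗ (suc m) = δ₀-0⃗ m

  defect-at-0 : ∀ u → δ₀ u ≡ 1ℤ → wt u ≡ 0 → defect u ≡ 0ℤ
  defect-at-0 u δ₀u≡1 wu≡0 rewrite δ₀u≡1 | wu≡0 = cancel C (Q u)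
    where
    cancel : ∀ c q → (0ℤ - c) * q + c * (1ℤ * q) ≡ 0ℤ
    cancel = solve-∀

  defect-off-0 : ∀ u → δ₀ u ≡ 0ℤ → defect u ≡ (+ wt u - C) * Q u
  defect-off-0 u δ₀u≡0 rewrite δ₀u≡0 = drop (+ wt u - C) C (Q u)
    where
    drop : ∀ a c q → a * q + c * (0ℤ * q) ≡ a * q
    drop = solve-∀

  defect-nonneg : SpectrumVanishesUpTo f c → ∀ u → 0ℤ ≤ defect u
  defect-nonneg vanishes u with δ₀-dichotomy u
  ... | inj₁ (δ₀u≡1 , wu≡0) = ℤP.≤-reflexive (sym (defect-at-0 u δ₀u≡1 wu≡0))
  ... | inj₂ (δ₀u≡0 , _) with wt u ℕ.≤? c
  ...   | yes wu≤c = ℤP.≤-reflexive (sym (begin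
          defect u                     ≡⟨ defect-off-0 u δ₀u≡0 ⟩
          (+ wt u - C) * Q u           ≡⟨ cong (λ a → (+ wt u - C) * (a * a)) (vanishes u δ₀u≡0 wu≤c) ⟩
          (+ wt u - C) * (0ℤ * 0ℤ)     ≡⟨ ℤP.*-zeroʳ (+ wt u - C) ⟩
          0ℤ                           ∎))
  ...   | no wu≰c = subst (0ℤ ≤_) (sym (defect-off-0 u δ₀u≡0))
                      (product-nonneg (+ wt u - C) (Q u) (ℤP.i≤j⇒0≤j-i (+≤+ (ℕP.≰⇒> wu≰c)))
                                      (square-nonneg (walsh f u)))

  defect≡0⇔onLevel : ∀ u → δ₀ u ≡ 0ℤ → defect u ≡ 0ℤ ⇔ (walsh f u ≡ 0ℤ ⊎ wt u ≡ suc c)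
  defect≡0⇔onLevel u δ₀u≡0 = mk⇔ to from
    where
    to : defect u ≡ 0ℤ → walsh f u ≡ 0ℤ ⊎ wt u ≡ suc c
    to defect≡0 with ℤP.i*j≡0⇒i≡0∨j≡0 (+ wt u - C) (trans (sym (defect-off-0 u δ₀u≡0)) defect≡0)
    ... | inj₁ w-C≡0 = inj₂ (ℤP.+-injective (ℤP.i-j≡0⇒i≡j _ _ w-C≡0))
    ... | inj₂ Q≡0 = inj₁ (reduce (ℤP.i*j≡0⇒i≡0∨j≡0 (walsh f u) Q≡0))
    from : walsh f u ≡ 0ℤ ⊎ wt u ≡ suc c → defect u ≡ 0ℤ
    from (inj₁ f̂u≡0) = trans (defect-off-0 u δ₀u≡0)
      (trans (cong (λ a → (+ wt u - C) * (a * a)) f̂u≡0) (ℤP.*-zeroʳ (+ wt u - C)))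
    from (inj₂ wu≡C) = trans (defect-off-0 u δ₀u≡0)
      (trans (cong (λ w → (+ w - C) * Q u) wu≡C) (trans (cong (_* Q u) (ℤP.+-inverseʳ C)) (ℤP.*-zeroˡ (Q u))))

  excess-nonneg : SpectrumVanishesUpTo f c → 0ℤ ≤ excessOf f c
  excess-nonneg vanishes =
    subst (0ℤ ≤_) energy-identity
          (product-nonneg (+ 2) (∑ defect) (+≤+ z≤n) (∑-nonneg defect (defect-nonneg vanishes)))

  excess≡0⇔onLevel : SpectrumVanishesUpTo f c → excessOf f c ≡ 0ℤ ⇔ SpectrumOnLevel f (suc c)
  excess≡0⇔onLevel vanishes = mk⇔ to from
    where
    to : excessOf f c ≡ 0ℤ → SpectrumOnLevel f (suc c)
    to excess≡0 u δ₀u≡0 = Equivalence.to (defect≡0⇔onLevel u δ₀u≡0)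
      (∑-nonneg-≡0 defect (defect-nonneg vanishes) ∑defect≡0 u)
      where
      ∑defect≡0 : ∑ defect ≡ 0ℤ
      ∑defect≡0 = ℤP.*-cancelˡ-≡ (+ 2) (∑ defect) 0ℤ
                    (trans (trans energy-identity excess≡0) (sym (ℤP.*-zeroʳ (+ 2))))
    from : SpectrumOnLevel f (suc c) → excessOf f c ≡ 0ℤ
    from on-level = begin
      excessOf f c            ≡⟨ sym energy-identity ⟩
      + 2 * ∑ defect          ≡⟨ cong (+ 2 *_) (trans (∑-cong defect≡0) (∑-0 {n})) ⟩
      + 2 * 0ℤ                ≡⟨⟩
      0ℤ                      ∎
      where
      defect≡0 : ∀ u → defect u ≡ 0ℤ
      defect≡0 u with δ₀-dichotomy u
      ... | inj₁ (δ₀u≡1 , wu≡0) = defect-at-0 u δ₀u≡1 wu≡0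
      ... | inj₂ (δ₀u≡0 , _) = Equivalence.from (defect≡0⇔onLevel u δ₀u≡0) (on-level u δ₀u≡0)

-- Rational arithmetic

ℚ-ring : ACR.AlmostCommutativeRing 0ℓ 0ℓ
ℚ-ring = ACR.fromCommutativeRing ℚP.+-*-commutativeRing (λ q → dec⇒maybe (0ℚ ℚP.≟ q))

ι : ℤ → ℚ
ι z = z ℚ./ 1

toℚᵘ-ι : ∀ z → toℚᵘ (ι z) ≃ᵘ mkℚᵘ z 0
toℚᵘ-ι z = ℚP.toℚᵘ-fromℚᵘ (mkℚᵘ z 0)

ι-+ : ∀ a b → ι (a + b) ≡ ι a ℚ.+ ι b
ι-+ a b = ℚP.toℚᵘ-injective (ℚᵘP.≃-trans (toℚᵘ-ι (a + b)) (ℚᵘP.≃-trans (*≡* (unit a b))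
            (ℚᵘP.≃-sym (ℚᵘP.≃-trans (ℚP.toℚᵘ-homo-+ (ι a) (ι b))
                                    (ℚᵘP.+-cong (toℚᵘ-ι a) (toℚᵘ-ι b))))))
  where
  unit : ∀ a b → (a + b) * 1ℤ ≡ (a * 1ℤ + b * 1ℤ) * 1ℤ
  unit = solve-∀

ι-* : ∀ a b → ι (a * b) ≡ ι a ℚ.* ι b
ι-* a b = ℚP.toℚᵘ-injective (ℚᵘP.≃-trans (toℚᵘ-ι (a * b))
            (ℚᵘP.≃-sym (ℚᵘP.≃-trans (ℚP.toℚᵘ-homo-* (ι a) (ι b))
                                    (ℚᵘP.*-cong (toℚᵘ-ι a) (toℚᵘ-ι b)))))

ι-neg : ∀ a → ι (- a) ≡ ℚ.- ι a
ι-neg a = ℚP.toℚᵘ-injective (ℚᵘP.≃-trans (toℚᵘ-ι (- a))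
            (ℚᵘP.≃-sym (ℚᵘP.≃-trans (ℚP.toℚᵘ-homo‿- (ι a)) (ℚᵘP.-‿cong (toℚᵘ-ι a)))))

ι-- : ∀ a b → ι (a - b) ≡ ι a ℚ.- ι b
ι-- a b = trans (ι-+ a (- b)) (cong (ι a ℚ.+_) (ι-neg b))

ι-nonneg : ∀ {z} → 0ℤ ≤ z → 0ℚ ℚ.≤ ι z
ι-nonneg {z} 0≤z = ℚP.toℚᵘ-cancel-≤
  (ℚᵘP.≤-respʳ-≃ (ℚᵘP.≃-sym (toℚᵘ-ι z)) (*≤* (subst (0ℤ ≤_) (sym (ℤP.*-identityʳ z)) 0≤z)))

ι≡0⇒≡0 : ∀ {z} → ι z ≡ 0ℚ → z ≡ 0ℤ
ι≡0⇒≡0 {z} ιz≡0 with ℚᵘP.≃-trans (ℚᵘP.≃-sym (toℚᵘ-ι z)) (ℚP.toℚᵘ-cong ιz≡0)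
... | *≡* z*1≡0 = trans (sym (ℤP.*-identityʳ z)) z*1≡0

frac-* : ∀ a d → frac a (suc d) ℚ.* ι (+ suc d) ≡ ι (+ a)
frac-* a d = ℚP.toℚᵘ-injective (ℚᵘP.≃-trans (ℚP.toℚᵘ-homo-* (frac a (suc d)) (ι (+ suc d)))
  (ℚᵘP.≃-trans (ℚᵘP.*-cong (ℚP.toℚᵘ-fromℚᵘ (mkℚᵘ (+ a) d)) (toℚᵘ-ι (+ suc d)))
  (ℚᵘP.≃-trans (*≡* (trans (unit (+ a) (+ suc d)) (cong (λ k → + a * + k) (sym (ℕP.*-identityʳ (suc d))))))
               (ℚᵘP.≃-sym (toℚᵘ-ι (+ a))))))
  where
  unit : ∀ a b → (a * b) * 1ℤ ≡ a * b
  unit = solve-∀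

-- multiplying by a positive K and shifting by ι D is strictly monotone, so the sign of D decides
sign-transfer : ∀ (x y K : ℚ) .{{_ : Positive K}} (D : ℤ) → x ℚ.* K ℚ.+ ι D ≡ y ℚ.* K →
                (0ℤ ≤ D → x ℚ.≤ y) × (x ≡ y ⇔ D ≡ 0ℤ)
sign-transfer x y K D balance = nonneg⇒≤ , mk⇔ to from
  where
  nonneg⇒≤ : 0ℤ ≤ D → x ℚ.≤ y
  nonneg⇒≤ 0≤D = ℚP.*-cancelʳ-≤-pos K (subst₂ ℚ._≤_ (ℚP.+-identityʳ (x ℚ.* K)) balance
                                           (ℚP.+-monoʳ-≤ (x ℚ.* K) (ι-nonneg 0≤D)))
  to : x ≡ y → D ≡ 0ℤ
  to refl = ι≡0⇒≡0 (trans (isolate (x ℚ.* K) (ι D))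
                           (trans (cong (ℚ._- x ℚ.* K) balance) (ℚP.+-inverseʳ (x ℚ.* K))))
    where
    isolate : ∀ p q → q ≡ (p ℚ.+ q) ℚ.- p
    isolate = RingSolver.solve-∀ ℚ-ring
  from : D ≡ 0ℤ → x ≡ y
  from refl = ℚP.≤-antisym (ℚP.*-cancelʳ-≤-pos K (ℚP.≤-reflexive xK≡yK))
                           (ℚP.*-cancelʳ-≤-pos K (ℚP.≤-reflexive (sym xK≡yK)))
    where
    xK≡yK : x ℚ.* K ≡ y ℚ.* K
    xK≡yK = trans (sym (ℚP.+-identityʳ (x ℚ.* K))) balance

ι-*₃ : ∀ a b c → ι (a * b * c) ≡ ι a ℚ.* ι b ℚ.* ι c
ι-*₃ a b c = trans (ι-* (a * b) c) (cong (ℚ._* ι c) (ι-* a b))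

ι-excess : ∀ n B s N C → ι (excess n B s N C) ≡
  ι n ℚ.* ι N ℚ.* ι s ℚ.- ι N ℚ.* (ι B ℚ.- ι s)
    ℚ.- ι (+ 2) ℚ.* ι C ℚ.* ι N ℚ.* ι s ℚ.+ ι (+ 2) ℚ.* ι C ℚ.* (ι s ℚ.* ι s)
ι-excess n B s N C =
  trans (ι-+ (n * N * s - N * (B - s) - + 2 * C * N * s) (+ 2 * C * (s * s)))
  (cong₂ ℚ._+_
    (trans (ι-- (n * N * s - N * (B - s)) (+ 2 * C * N * s))
      (cong₂ ℚ._-_
        (trans (ι-- (n * N * s) (N * (B - s)))
          (cong₂ ℚ._-_ (ι-*₃ n N s) (trans (ι-* N (B - s)) (cong (ι N ℚ.*_) (ι-- B s)))))
        (trans (ι-* (+ 2 * C * N) s) (cong (ℚ._* ι s) (ι-*₃ (+ 2) C N)))))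
    (trans (ι-* (+ 2 * C) (s * s)) (cong₂ ℚ._*_ (ι-* (+ 2) C) (ι-* s s))))

excess-balance : ∀ n B s N C →
  let X = (frac B (suc s) ℚ.- 1ℚ) ℚ.+ ℕtoℚ 2 ℚ.* ℕtoℚ C ℚ.* (1ℚ ℚ.- frac (suc s) (suc N))
      K = ℕtoℚ (suc s) ℚ.* ℕtoℚ (suc N)
  in X ℚ.* K ℚ.+ ι (excess (+ n) (+ B) (+ suc s) (+ suc N) (+ C)) ≡ ℕtoℚ n ℚ.* K
excess-balance n B s N C = begin
  X ℚ.* (σ ℚ.* ν) ℚ.+ ι (excess (+ n) (+ B) (+ suc s) (+ suc N) (+ C))
    ≡⟨ cong (X ℚ.* (σ ℚ.* ν) ℚ.+_) (ι-excess (+ n) (+ B) (+ suc s) (+ suc N) (+ C)) ⟩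
  X ℚ.* (σ ℚ.* ν) ℚ.+
    (η ℚ.* ν ℚ.* σ ℚ.- ν ℚ.* (β ℚ.- σ) ℚ.- τ ℚ.* γ ℚ.* ν ℚ.* σ ℚ.+ τ ℚ.* γ ℚ.* (σ ℚ.* σ))
    ≡⟨ expand a r η β σ ν τ γ ⟩
  η ℚ.* (σ ℚ.* ν) ℚ.+ ν ℚ.* (a ℚ.* σ ℚ.- β) ℚ.- τ ℚ.* γ ℚ.* σ ℚ.* (r ℚ.* ν ℚ.- σ)
    ≡⟨ cong₂ (λ p q → η ℚ.* (σ ℚ.* ν) ℚ.+ ν ℚ.* (p ℚ.- β) ℚ.- τ ℚ.* γ ℚ.* σ ℚ.* (q ℚ.- σ))
             (frac-* B s) (frac-* (suc s) N) ⟩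
  η ℚ.* (σ ℚ.* ν) ℚ.+ ν ℚ.* (β ℚ.- β) ℚ.- τ ℚ.* γ ℚ.* σ ℚ.* (σ ℚ.- σ)
    ≡⟨ collapse η β σ ν τ γ ⟩
  η ℚ.* (σ ℚ.* ν) ∎
  where
  a = frac B (suc s)
  r = frac (suc s) (suc N)
  η = ℕtoℚ n
  β = ℕtoℚ B
  σ = ℕtoℚ (suc s)
  ν = ℕtoℚ (suc N)
  τ = ℕtoℚ 2
  γ = ℕtoℚ C
  X = (a ℚ.- 1ℚ) ℚ.+ τ ℚ.* γ ℚ.* (1ℚ ℚ.- r)
  expand : ∀ a r η β σ ν τ γ →
    ((a ℚ.- 1ℚ) ℚ.+ τ ℚ.* γ ℚ.* (1ℚ ℚ.- r)) ℚ.* (σ ℚ.* ν) ℚ.+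
      (η ℚ.* ν ℚ.* σ ℚ.- ν ℚ.* (β ℚ.- σ) ℚ.- τ ℚ.* γ ℚ.* ν ℚ.* σ ℚ.+ τ ℚ.* γ ℚ.* (σ ℚ.* σ)) ≡
    η ℚ.* (σ ℚ.* ν) ℚ.+ ν ℚ.* (a ℚ.* σ ℚ.- β) ℚ.- τ ℚ.* γ ℚ.* σ ℚ.* (r ℚ.* ν ℚ.- σ)
  expand = RingSolver.solve-∀ ℚ-ring
  collapse : ∀ η β σ ν τ γ →
    η ℚ.* (σ ℚ.* ν) ℚ.+ ν ℚ.* (β ℚ.- β) ℚ.- τ ℚ.* γ ℚ.* σ ℚ.* (σ ℚ.- σ) ≡ η ℚ.* (σ ℚ.* ν)
  collapse = RingSolver.solve-∀ ℚ-ring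

excess-sign : ∀ n B s N C → 0 ℕ.< s → 0 ℕ.< N →
  let X = (frac B s ℚ.- 1ℚ) ℚ.+ ℕtoℚ 2 ℚ.* ℕtoℚ C ℚ.* (1ℚ ℚ.- frac s N)
      D = excess (+ n) (+ B) (+ s) (+ N) (+ C)
  in (0ℤ ≤ D → X ℚ.≤ ℕtoℚ n) × (X ≡ ℕtoℚ n ⇔ D ≡ 0ℤ)
excess-sign n B (suc s) (suc N) C _ _ =
  sign-transfer _ (ℕtoℚ n) (ℕtoℚ (suc s) ℚ.* ℕtoℚ (suc N))
    {{ℚP.pos*pos⇒pos (ℕtoℚ (suc s)) {{ℚP.normalize-pos (suc s) 1}}
                     (ℕtoℚ (suc N)) {{ℚP.normalize-pos (suc N) 1}}}}
    _ (excess-balance n B s N C)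

theorem1 : (n : ℕ) → n ≥ 1 → (S : Subset n) → NonEmpty S → (c : ℕ) → IsCor S c →
    ((density S ℚ.≤ ½ →
    nei S ℚ.+ ℕtoℚ 2 ℚ.* ℕtoℚ (suc c) ℚ.* (1ℚ ℚ.- density S) ℚ.≤ ℕtoℚ n)
    × (PerfectColouring S ⇔
    (nei S ℚ.+ ℕtoℚ 2 ℚ.* ℕtoℚ (suc c) ℚ.* (1ℚ ℚ.- density S) ≡ ℕtoℚ n)))
theorem1 n _ S (x , x∈S) c cor@(c≤n , immune , _) = (λ _ → bound) , characterisation
  where
  f = indicator S
  B = sumL (λ x → if S x then ballCount S x else 0) (allVecs n)
  D = excess (+ n) (+ B) (+ card S) (+ (2 ℕ.^ n)) (+ suc c)
  sign = excess-sign n B (card S) (2 ℕ.^ n) (suc c)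
           (countTrue-pos S (allVecs-complete x) x∈S) (ℕP.m^n>0 2 n)
  D≡excess : D ≡ excessOf f c
  D≡excess = cong₂ (λ b s → excess (+ n) b s (cubeSize n) (+ suc c)) (sumL-ballCount S) (countTrue-allVecs S)
  vanishes = corrImmune⇒spectrum-vanishes S c c≤n immune
  bound = proj₁ sign (subst (0ℤ ≤_) (sym D≡excess) (excess-nonneg f (indicator-idempotent S) c vanishes))
  onLevel⇔D≡0 : SpectrumOnLevel f (suc c) ⇔ D ≡ 0ℤ
  onLevel⇔D≡0 = subst (λ e → SpectrumOnLevel f (suc c) ⇔ e ≡ 0ℤ) (sym D≡excess)
                      (⇔-sym (excess≡0⇔onLevel f (indicator-idempotent S) c vanishes))
  characterisation = ⇔-trans (perfect⇔spectrumOnLevel S c cor) (⇔-trans onLevel⇔D≡0 (⇔-sym (proj₂ sign)))
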